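{- For every integer $n\ge 1$, $$9H_{n+2}-2H_{n+1}+35H_n=41K_n.$$
   Context: The generalized Tribonacci sequence $(H_n)_{n\ge0}$ is defined by $H_0=3$, $H_1=0$, $H_2=2$ and $H_{n+2}=H_{n+1}+H_n+H_{n-1}$ for $n\ge1$. The Tribonacci–Lucas sequence is $K_0=3$, $K_1=1$, $K_2=3$, $K_n=K_{n-1}+K_{n-2}+K_{n-3}$ ($n\ge3$). -}

module Defs where

open import Data.Nat using (ℕ; zero; suc; _+_)

H : ℕ → ℕ
H 0 = 3
H 1 = 0
H 2 = 2
H (suc (suc (suc n))) = H (suc (suc n)) + H (suc n) + H n

K : ℕ → ℕ
K 0 = 3
K 1 = 1
K 2 = 3
K (suc (suc (suc n))) = K (suc (suc n)) + K (suc n) + K n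

module Submission where

-- Call an integer sequence f "Tribonacci" when
-- f (n + 3) = f (n + 2) + f (n + 1) + f n for every n.  Such sequences
-- form a ℤ-module that is closed under index shifts, and a Tribonacci
-- sequence is determined by its first three terms.  Both sides of the
-- identity, read as sequences in n, are Tribonacci: the left side is a
-- linear combination of shifts of H, the right side a multiple of K.
-- They agree at n = 0, 1, 2 (123, 41, 123), hence everywhere; in
-- particular the identity holds for all n ≥ 1 (and also for n = 0).

open import Defs
open import Data.Nat using (ℕ; _≥_; zero; suc)
import Data.Nat as ℕ
open import Data.Integer using (ℤ; +_; _+_; _-_; _*_)
open import Data.Integer.Properties using (pos-+)
open import Data.Integer.Tactic.RingSolver using (solve-∀)
open import Data.Product using (_×_; _,_; proj₁)
open import Relation.Binary.PropositionalEquality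
  using (_≡_; refl; sym; cong; cong₂; trans)

-- The Tribonacci recurrence, imposed from index 0 on.  A record (rather
-- than a bare Π-type) so that the sequence can be inferred from a proof.
record Tribonacci (f : ℕ → ℤ) : Set where
  constructor tribonacci
  field recurrence : ∀ n → f (3 ℕ.+ n) ≡ f (2 ℕ.+ n) + f (1 ℕ.+ n) + f n

open Tribonacci

-- Shifting the index by k preserves the recurrence; since
-- (3 + n) + k reduces to 3 + (n + k), this is the recurrence at n + k.
shift : ∀ {f} k → Tribonacci f → Tribonacci (λ n → f (n ℕ.+ k))
shift k tf = tribonacci λ n → recurrence tf (n ℕ.+ k)

scale : ∀ {f} c → Tribonacci f → Tribonacci (λ n → c * f n)
scale {f} c tf = tribonacci λ n →
  trans (cong (c *_) (recurrence tf n)) (distrib c (f (2 ℕ.+ n)) (f (1 ℕ.+ n)) (f n))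
  where
  distrib : ∀ c x y z → c * (x + y + z) ≡ c * x + c * y + c * z
  distrib = solve-∀

add : ∀ {f g} → Tribonacci f → Tribonacci g → Tribonacci (λ n → f n + g n)
add {f} {g} tf tg = tribonacci λ n →
  trans (cong₂ _+_ (recurrence tf n) (recurrence tg n))
        (regroup (f (2 ℕ.+ n)) (f (1 ℕ.+ n)) (f n) (g (2 ℕ.+ n)) (g (1 ℕ.+ n)) (g n))
  where
  regroup : ∀ a b c x y z → (a + b + c) + (x + y + z) ≡ (a + x) + (b + y) + (c + z)
  regroup = solve-∀

sub : ∀ {f g} → Tribonacci f → Tribonacci g → Tribonacci (λ n → f n - g n)
sub {f} {g} tf tg = tribonacci λ n →
  trans (cong₂ _-_ (recurrence tf n) (recurrence tg n))
        (regroup (f (2 ℕ.+ n)) (f (1 ℕ.+ n)) (f n) (g (2 ℕ.+ n)) (g (1 ℕ.+ n)) (g n))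
  where
  regroup : ∀ a b c x y z → (a + b + c) - (x + y + z) ≡ (a - x) + (b - y) + (c - z)
  regroup = solve-∀

agree : ∀ {f g} → Tribonacci f → Tribonacci g →
        f 0 ≡ g 0 → f 1 ≡ g 1 → f 2 ≡ g 2 → ∀ n → f n ≡ g n
agree {f} {g} tf tg e₀ e₁ e₂ n = proj₁ (window n)
  where
  window : ∀ n → f n ≡ g n × f (1 ℕ.+ n) ≡ g (1 ℕ.+ n) × f (2 ℕ.+ n) ≡ g (2 ℕ.+ n)
  window zero = e₀ , e₁ , e₂
  window (suc n) with window n
  ... | p , q , r = q , r , next
    where
    next : f (3 ℕ.+ n) ≡ g (3 ℕ.+ n)
    next = trans (recurrence tf n) (trans (cong₂ _+_ (cong₂ _+_ r q) p) (sym (recurrence tg n)))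

natTribonacci : ∀ (u : ℕ → ℕ) → (∀ n → u (3 ℕ.+ n) ≡ u (2 ℕ.+ n) ℕ.+ u (1 ℕ.+ n) ℕ.+ u n) →
                Tribonacci (λ n → + u n)
natTribonacci u rec = tribonacci λ n →
  trans (cong +_ (rec n))
        (trans (pos-+ (u (2 ℕ.+ n) ℕ.+ u (1 ℕ.+ n)) (u n))
               (cong (_+ + u n) (pos-+ (u (2 ℕ.+ n)) (u (1 ℕ.+ n)))))

H-Tribonacci : Tribonacci (λ n → + H n)
H-Tribonacci = natTribonacci H (λ n → refl)

K-Tribonacci : Tribonacci (λ n → + K n)
K-Tribonacci = natTribonacci K (λ n → refl)

-- Both sides are Tribonacci in n and agree at n = 0, 1, 2, so they agree
-- for every n.
theorem2p3 : (n : ℕ) → n ≥ 1 →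
    (+ 9) * (+ H (n Data.Nat.+ 2)) - (+ 2) * (+ H (n Data.Nat.+ 1)) + (+ 35) * (+ H n) ≡ (+ 41) * (+ K n)
theorem2p3 n _ = agree lhs rhs refl refl refl n
  where
  lhs : Tribonacci (λ n → (+ 9) * (+ H (n ℕ.+ 2)) - (+ 2) * (+ H (n ℕ.+ 1)) + (+ 35) * (+ H n))
  lhs = add (sub (scale (+ 9) (shift 2 H-Tribonacci))
                 (scale (+ 2) (shift 1 H-Tribonacci)))
            (scale (+ 35) H-Tribonacci)

  rhs : Tribonacci (λ n → (+ 41) * (+ K n))
  rhs = scale (+ 41) K-Tribonacci
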